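{- Let $\Gamma$ be a nonempty finite set of formulas in $For_1$. Then the sequent $\Gamma\Rightarrow$ (with empty succedent) is not provable in $\mathbf{H}$.
   Context: Fix a denumerable set $prop$ of propositional variables. $For_1$ is the set of formulas built from $prop$ with unary $\lnot$ and binary $\vee$. $var(\alpha)$ is the set of propositional variables in $\alpha$; $var(\Delta)=\bigcup_{\delta\in\Delta}var(\delta)$. A sequent $\Gamma\Rightarrow\Delta$ is an ordered pair of finite sets of formulas, not both empty; $\Gamma\Rightarrow$ denotes $\Gamma\Rightarrow\emptyset$; $\alpha,\Gamma$ denotes $\Gamma\cup\{\alpha\}$. The calculus $\mathbf{H}$ has the axiom $\alpha\Rightarrow\alpha$ and the rules (premises / conclusion): (W$\Rightarrow$) $\Gamma\Rightarrow\Delta$ / $\alpha,\Gamma\Rightarrow\Delta$; ($\Rightarrow$W) $\Gamma\Rightarrow\Delta$ / $\Gamma\Rightarrow\Delta,\alpha$; (Cut) $\Gamma\Rightarrow\Delta,\alpha$ and $\alpha,\Gamma\Rightarrow\Delta$ / $\Gamma\Rightarrow\Delta$; ($\Rightarrow\lnot$) $\alpha,\Gamma\Rightarrow\Delta$ / $\Gamma\Rightarrow\Delta,\lnot\alpha$; ($\lnot^H\Rightarrow$) $\Gamma\Rightarrow\Delta,\alpha$ / $\lnot\alpha,\Gamma\Rightarrow\Delta$, allowed only if $var(\alpha)\subseteq var(\Delta)$; ($\vee\Rightarrow$) $\alpha_1,\Gamma\Rightarrow\Delta$ and $\alpha_2,\Gamma\Rightarrow\Delta$ / $\alpha_1\vee\alpha_2,\Gamma\Rightarrow\Delta$;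 ($\Rightarrow\vee$) $\Gamma\Rightarrow\Delta,\alpha_1,\alpha_2$ / $\Gamma\Rightarrow\Delta,\alpha_1\vee\alpha_2$. -}

module Defs where

open import Data.Nat using (ℕ)
open import Data.List using (List; []; _∷_; _++_; concatMap)
open import Data.List.Membership.Propositional using (_∈_)
open import Data.List.Relation.Binary.Subset.Propositional using (_⊆_)
open import Data.Product using (_×_)
open import Data.Sum using (_⊎_)
open import Relation.Binary.PropositionalEquality using (_≢_)

Prop : Set
Prop = ℕ

-- For_1 : formulas built from prop with ¬ and ∨
data Formula : Set where
  var : Prop → Formula
  ¬_  : Formula → Formula
  _∨_ : Formula → Formula → Formula

infix 30 ¬_
infixr 20 _∨_

-- var(α) as a list (membership = set of variables)
vars : Formula → List Prop
vars (var p) = p ∷ []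
vars (¬ a) = vars a
vars (a ∨ b) = vars a ++ vars b

varsL : List Formula → List Prop
varsL = concatMap vars

-- finite sets of formulas are represented by lists, identified up to
-- having the same members
_≋_ : List Formula → List Formula → Set
Γ ≋ Γ' = (Γ ⊆ Γ') × (Γ' ⊆ Γ)

IsSequent : List Formula → List Formula → Set
IsSequent Γ Δ = (Γ ≢ []) ⊎ (Δ ≢ [])

-- derivability in the calculus H.  α , Γ is rendered as α ∷ Γ and
-- Δ , α as α ∷ Δ; the rule `set` expresses that sequents are pairs of
-- finite *sets*, so list representations with the same members are identified.
infix 5 H⊢_⇒_
data H⊢_⇒_ : List Formula → List Formula → Set where
  set   : ∀ {Γ Δ Γ' Δ'} → Γ ≋ Γ' → Δ ≋ Δ' → H⊢ Γ ⇒ Δ → H⊢ Γ' ⇒ Δ'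
  ax    : ∀ α → H⊢ α ∷ [] ⇒ α ∷ []
  W⇒    : ∀ {Γ Δ} α → H⊢ Γ ⇒ Δ → H⊢ α ∷ Γ ⇒ Δ
  ⇒W    : ∀ {Γ Δ} α → H⊢ Γ ⇒ Δ → H⊢ Γ ⇒ α ∷ Δ
  cut   : ∀ {Γ Δ} α → IsSequent Γ Δ →
          H⊢ Γ ⇒ α ∷ Δ → H⊢ α ∷ Γ ⇒ Δ → H⊢ Γ ⇒ Δ
  ⇒¬    : ∀ {Γ Δ α} → H⊢ α ∷ Γ ⇒ Δ → H⊢ Γ ⇒ (¬ α) ∷ Δ
  ¬H⇒   : ∀ {Γ Δ α} → (∀ {x} → x ∈ vars α → x ∈ varsL Δ) →
          H⊢ Γ ⇒ α ∷ Δ → H⊢ (¬ α) ∷ Γ ⇒ Δ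
  ∨⇒    : ∀ {Γ Δ α₁ α₂} → H⊢ α₁ ∷ Γ ⇒ Δ → H⊢ α₂ ∷ Γ ⇒ Δ →
          H⊢ (α₁ ∨ α₂) ∷ Γ ⇒ Δ
  ⇒∨    : ∀ {Γ Δ α₁ α₂} → H⊢ Γ ⇒ α₂ ∷ α₁ ∷ Δ → H⊢ Γ ⇒ (α₁ ∨ α₂) ∷ Δ

module Submission where

-- H is sound for the three-valued "paraconsistent weak Kleene"
-- semantics: truth values t, f, u, where the value u is infectious (a
-- formula is u as soon as one of its variables is u) and both t and u are
-- designated.  A sequent Γ ⇒ Δ is valid when every valuation designating
-- all of Γ designates some member of Δ.  The only rule whose soundness is
-- not a routine truth-table check is the restricted rule (¬ᴴ⇒): when both
-- α and ¬α are designated, α must be u, so some variable of α is u; the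
-- side condition var(α) ⊆ var(Δ) puts that variable into a formula of Δ,
-- which is then u and hence designated.
--
-- The theorem follows
-- because the valuation sending every variable to u designates every
-- formula, so no sequent with empty succedent is valid; non-emptiness of Γ
-- only serves to make Γ ⇒ a well-formed sequent.

open import Defs
open import Data.List using (List; [])
open import Data.List.Relation.Unary.All using (All; _∷_; tabulate)
open import Data.List.Relation.Unary.Any using (Any; here; there)
import Data.List.Relation.Unary.Any as Any
open import Data.List.Relation.Unary.Any.Properties using (++⁻; ++⁺ˡ; ++⁺ʳ; concatMap⁻)
open import Data.List.Relation.Binary.Subset.Propositional using (_⊆_)
open import Data.List.Relation.Binary.Subset.Propositional.Properties using (Any-resp-⊆; All-resp-⊇)
open import Data.Product using (_,_)
open import Data.Sum using (_⊎_; inj₁; inj₂)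
open import Data.Unit using (⊤; tt)
open import Data.Empty using (⊥)
open import Relation.Binary.PropositionalEquality using (_≡_; _≢_; refl; cong)
open import Relation.Nullary using () renaming (¬_ to Not)

data Val : Set where
  t f u : Val

neg : Val → Val
neg t = f
neg f = t
neg u = u

or : Val → Val → Val
or u _ = u
or t u = u
or t _ = t
or f b = b

Designated : Val → Set
Designated f = ⊥
Designated _ = ⊤

Valuation : Set
Valuation = Prop → Val

eval : Valuation → Formula → Val
eval v (var p) = v p
eval v (¬ α)   = neg (eval v α)
eval v (α ∨ β) = or (eval v α) (eval v β)

_⊨_ : Valuation → Formula → Set
v ⊨ α = Designated (eval v α)

undefined-designated : ∀ {a} → a ≡ u → Designated a
undefined-designated refl = tt

designated-or-neg : ∀ a → Designated a ⊎ Designated (neg a)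
designated-or-neg t = inj₁ tt
designated-or-neg f = inj₂ tt
designated-or-neg u = inj₁ tt

designated-with-neg : ∀ a → Designated a → Designated (neg a) → a ≡ u
designated-with-neg u _ _ = refl

or-designatedˡ : ∀ a b → Designated a → Designated (or a b)
or-designatedˡ t t _ = tt
or-designatedˡ t f _ = tt
or-designatedˡ t u _ = tt
or-designatedˡ u b _ = tt

or-designatedʳ : ∀ a b → Designated b → Designated (or a b)
or-designatedʳ t t _ = tt
or-designatedʳ t f _ = tt
or-designatedʳ t u _ = tt
or-designatedʳ f b d = d
or-designatedʳ u b _ = tt

or-designated⁻ : ∀ a b → Designated (or a b) → Designated a ⊎ Designated b
or-designated⁻ t b _ = inj₁ tt
or-designated⁻ f b d = inj₂ d
or-designated⁻ u b _ = inj₁ tt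

or-undefinedˡ : ∀ {a} b → a ≡ u → or a b ≡ u
or-undefinedˡ b refl = refl

or-undefinedʳ : ∀ a {b} → b ≡ u → or a b ≡ u
or-undefinedʳ t refl = refl
or-undefinedʳ f refl = refl
or-undefinedʳ u refl = refl

neg-undefined⁻ : ∀ a → neg a ≡ u → a ≡ u
neg-undefined⁻ u _ = refl

or-undefined⁻ : ∀ a b → or a b ≡ u → a ≡ u ⊎ b ≡ u
or-undefined⁻ u b _ = inj₁ refl
or-undefined⁻ t u _ = inj₂ refl
or-undefined⁻ f u _ = inj₂ refl

UndefinedVar : Valuation → Prop → Set
UndefinedVar v x = v x ≡ u

undefined-spreads : ∀ v α → Any (UndefinedVar v) (vars α) → eval v α ≡ u
undefined-spreads v (var p) (here e) = e
undefined-spreads v (¬ α) x∈α = cong neg (undefined-spreads v α x∈α)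
undefined-spreads v (α ∨ β) x∈αβ with ++⁻ (vars α) x∈αβ
... | inj₁ x∈α = or-undefinedˡ (eval v β) (undefined-spreads v α x∈α)
... | inj₂ x∈β = or-undefinedʳ (eval v α) (undefined-spreads v β x∈β)

undefined-source : ∀ v α → eval v α ≡ u → Any (UndefinedVar v) (vars α)
undefined-source v (var p) e = here e
undefined-source v (¬ α) e = undefined-source v α (neg-undefined⁻ (eval v α) e)
undefined-source v (α ∨ β) e with or-undefined⁻ (eval v α) (eval v β) e
... | inj₁ eα = ++⁺ˡ (undefined-source v α eα)
... | inj₂ eβ = ++⁺ʳ (vars α) (undefined-source v β eβ)

undefined-transfers : ∀ v α Δ → vars α ⊆ varsL Δ → eval v α ≡ u → Any (v ⊨_) Δ
undefined-transfers v α Δ α⊆Δ e =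
  Any.map (λ {δ} x∈δ → undefined-designated (undefined-spreads v δ x∈δ))
          (concatMap⁻ vars (Any-resp-⊆ α⊆Δ (undefined-source v α e)))

sound : ∀ {Γ Δ} → H⊢ Γ ⇒ Δ → ∀ v → All (v ⊨_) Γ → Any (v ⊨_) Δ
sound (set (Γ⊆Γ' , _) (Δ⊆Δ' , _) p) v vΓ' =
  Any-resp-⊆ Δ⊆Δ' (sound p v (All-resp-⊇ Γ⊆Γ' vΓ'))
sound (ax α) v (vα ∷ _) = here vα
sound (W⇒ α p) v (_ ∷ vΓ) = sound p v vΓ
sound (⇒W α p) v vΓ = there (sound p v vΓ)
sound (cut α _ p q) v vΓ with sound p v vΓ
... | here vα = sound q v (vα ∷ vΓ)
... | there vΔ = vΔ
sound (⇒¬ {α = α} p) v vΓ with designated-or-neg (eval v α)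
... | inj₁ vα = there (sound p v (vα ∷ vΓ))
... | inj₂ v¬α = here v¬α
sound (¬H⇒ {Δ = Δ} {α = α} α⊆Δ p) v (v¬α ∷ vΓ) with sound p v vΓ
... | here vα = undefined-transfers v α Δ α⊆Δ (designated-with-neg (eval v α) vα v¬α)
... | there vΔ = vΔ
sound (∨⇒ {α₁ = α} {α₂ = β} p q) v (vαβ ∷ vΓ)
  with or-designated⁻ (eval v α) (eval v β) vαβ
... | inj₁ vα = sound p v (vα ∷ vΓ)
... | inj₂ vβ = sound q v (vβ ∷ vΓ)
sound (⇒∨ {α₁ = α} {α₂ = β} p) v vΓ with sound p v vΓ
... | here vβ = here (or-designatedʳ (eval v α) (eval v β) vβ)
... | there (here vα) = here (or-designatedˡ (eval v α) (eval v β) vα)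
... | there (there vΔ) = there vΔ

everywhere-undefined : ∀ α → eval (λ _ → u) α ≡ u
everywhere-undefined (var p) = refl
everywhere-undefined (¬ α) = cong neg (everywhere-undefined α)
everywhere-undefined (α ∨ β) = or-undefinedˡ (eval (λ _ → u) β) (everywhere-undefined α)

no-empty-succedent : ∀ {Γ} → Not (H⊢ Γ ⇒ [])
no-empty-succedent p
  with sound p (λ _ → u) (tabulate (λ {γ} _ → undefined-designated (everywhere-undefined γ)))
... | ()

mainTheorem13 : (Γ : List Formula) → Γ ≢ [] → Not (H⊢ Γ ⇒ [])
mainTheorem13 Γ _ = no-empty-succedent
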